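{- The agents of $E_1$ are the only good agents that build the list $g_1$ while in state Census.
   Context: Mobile agents move synchronously in rounds in an anonymous port-labeled graph of size at most $n$. Good agents have pairwise distinct labels. There are at most $f$ Byzantine agents, which may behave arbitrarily, including transmitting arbitrary information and pretending to have arbitrary labels. Agents that are in the same node at the same round can exchange information. All agents execute the procedure MERGE$(\mathcal{T},n)$. An agent starting MERGE is in state Census for exactly one round: in that round it transmits its label to the agents in its node, and it assigns to a variable $H$ the lexicographically ordered list of all pairwise distinct labels of the agents that are currently in its node and in state Census. It then leaves state Census. Let $\tau_0$ be the first round at which a good agent starts MERGE. Assume every good agent starts MERGE by round $\tau_0+\mathcal{T}-1$. Assume at least $4f+2$ good agents start MERGE in the same node and at the same round. A list $L_2$ is larger than a list $L_3$ if $L_2$ has more elements than $L_3$, or the two lists have the same number of elements and $L_2$ is lexicographically larger than $L_3$. Let $g_1$ be the largest list $H$ built by any good agent in state Census. It follows that $g_1$ is built by a set of at least $3f+2$ good agents that are in state Census at the same round $\tau_1$ in the same node $v_1$. Let $E_1$ be the set of all good agents that are in state Census in node $v_1$ at round $\tau_1$. -}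

module Defs where

open import Data.Nat using (ℕ; _≤_; _<_; _+_; _*_; _≟_)
open import Data.Nat.Properties using (≤-decTotalOrder)
open import Data.Fin using (Fin)
import Data.Fin.Properties as FinP
open import Data.List using (List; []; _∷_; length; map; filter; mapMaybe; _++_; deduplicate; allFin)
open import Data.List.Relation.Binary.Lex.Strict using (Lex-<)
open import Data.List.Relation.Unary.Unique.Propositional using (Unique)
open import Data.List.Relation.Unary.All using (All)
open import Data.Maybe using (Maybe; just; nothing)
open import Data.Product using (Σ; _×_; _,_; ∃)
open import Data.Sum using (_⊎_)
open import Relation.Binary.PropositionalEquality using (_≡_)
open import Relation.Nullary.Decidable using (_×-dec_; yes; no)
open import Function.Definitions using (Injective)
open import Data.List.Sort ≤-decTotalOrder using (sort)

Label : Set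
Label = ℕ

-- An abstract execution of the census round of MERGE, with at most f
-- Byzantine agents, in a graph with at most n nodes.
record Execution (n f : ℕ) : Set where
  field
    nodes    : ℕ
    nodes≤n  : nodes ≤ n
    good     : ℕ
    byz      : ℕ
    byz≤f    : byz ≤ f
    label    : Fin good → Label
    label-inj : Injective _≡_ _≡_ label
    start    : Fin good → ℕ           -- round at which a good agent starts MERGE
                                      -- (it is in state Census exactly at that round)
    posG     : Fin good → ℕ → Fin nodes
    posB     : Fin byz → ℕ → Fin nodes
    -- at round t a Byzantine agent may (or may not) pretend to be in state
    -- Census with an arbitrary label, transmitted to the agents of its node
    claim    : Fin byz → ℕ → Maybe Label

module _ {n f : ℕ} (e : Execution n f) where
  open Execution e

  inCensus : ℕ → Fin nodes → Fin good → Set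
  inCensus t v g = start g ≡ t × posG g t ≡ v

  censusLabels : ℕ → Fin nodes → List Label
  censusLabels t v =
    map label (filter (λ g → (start g ≟ t) ×-dec (FinP._≟_ (posG g t) v)) (allFin good))
    ++ mapMaybe (λ b → byzClaim b (FinP._≟_ (posB b t) v)) (allFin byz)
    where
      byzClaim : (b : Fin byz) → _ → Maybe Label
      byzClaim b (yes _) = claim b t
      byzClaim b (no _)  = nothing

  HAt : ℕ → Fin nodes → List Label
  HAt t v = sort (deduplicate _≟_ (censusLabels t v))

  H : Fin good → List Label
  H g = HAt (start g) (posG g (start g))

_≺_ : List Label → List Label → Set
L₃ ≺ L₂ = length L₃ < length L₂ ⊎ (length L₃ ≡ length L₂ × Lex-< _≡_ _<_ L₃ L₂)

module Submission where

-- A good agent's list H is computed from the labels transmitted in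
-- its own Census round and node.  Those labels are the labels of the good
-- agents in Census there, plus at most f labels invented by Byzantine agents.
-- Now E₁ contains at least 3f+2 > f good agents, whose pairwise distinct
-- labels all occur in g₁.  If a good agent g builds g₁, these more than f
-- labels occur in H g, so not all of them can be Byzantine: some agent of E₁
-- was in Census together with g.  An agent is in Census at a single round and
-- node, hence g was in Census at round τ₁ in node v₁, i.e. g ∈ E₁.
-- Conversely every agent of E₁ sees the same census as the agents building
-- g₁, hence builds g₁ too.

open import Defs
open import Data.Nat using (ℕ; _≤_; _<_; _+_; _*_; _≟_; suc; z≤n; s≤s; z<s)
open import Data.Nat.Properties using (≤-trans; ≤-<-trans; <-irrefl; m≤n*m; m<m+n; +-suc; ≤-decTotalOrder; module ≤-Reasoning)
open import Data.Fin using (Fin)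
import Data.Fin.Properties as FinP
open import Data.List using (List; []; _∷_; _++_; length; map; filter; mapMaybe; allFin)
open import Data.List.Properties using (length-++; length-map; length-mapMaybe; length-tabulate)
open import Data.List.Relation.Unary.Unique.Propositional using (Unique)
open import Data.List.Relation.Unary.Unique.Propositional.Properties using (map⁺)
open import Data.List.Relation.Unary.All using (All; []; _∷_)
import Data.List.Relation.Unary.All as All
open import Data.List.Relation.Unary.AllPairs using (_∷_)
open import Data.List.Relation.Unary.Any using (Any; here; there)
open import Data.List.Membership.Propositional using (_∈_)
open import Data.List.Membership.Propositional.Properties
  using (∈-∃++; ∈-++⁺ˡ; ∈-++⁺ʳ; ∈-++⁻; ∈-allFin; ∈-map∘filter⁺; ∈-map∘filter⁻; ∈-deduplicate⁺; ∈-deduplicate⁻)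
open import Data.List.Relation.Binary.Permutation.Propositional using (↭-sym)
open import Data.List.Relation.Binary.Permutation.Propositional.Properties using (∈-resp-↭)
open import Data.List.Sort ≤-decTotalOrder using (sort-↭)
open import Data.Product using (Σ; _×_; _,_; ∃)
open import Data.Sum using (_⊎_; inj₁; inj₂)
open import Data.Empty using (⊥-elim)
open import Relation.Binary.PropositionalEquality using (_≡_; _≢_; refl; sym; trans; cong; subst)
open import Relation.Nullary using (¬_; Dec)
open import Relation.Nullary.Decidable using (_×-dec_)
open import Function.Bundles using (_⇔_; mk⇔)

∈-remove : ∀ {A : Set} {x y : A} us vs → x ≢ y → y ∈ us ++ x ∷ vs → y ∈ us ++ vs
∈-remove us vs x≢y y∈ with ∈-++⁻ us y∈
... | inj₁ y∈us         = ∈-++⁺ˡ y∈us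
... | inj₂ (here y≡x)   = ⊥-elim (x≢y (sym y≡x))
... | inj₂ (there y∈vs) = ∈-++⁺ʳ us y∈vs

unique-⊆⇒length-≤ : ∀ {A : Set} (xs ys : List A) →
  Unique xs → All (_∈ ys) xs → length xs ≤ length ys
unique-⊆⇒length-≤ []       ys _                  _               = z≤n
unique-⊆⇒length-≤ (x ∷ xs) ys (x∉xs ∷ xs-unique) (x∈ys ∷ xs⊆ys) with ∈-∃++ x∈ys
... | us , vs , refl = begin
  suc (length xs)             ≤⟨ s≤s (unique-⊆⇒length-≤ xs (us ++ vs) xs-unique xs⊆us++vs) ⟩
  suc (length (us ++ vs))     ≡⟨ cong suc (length-++ us) ⟩
  suc (length us + length vs) ≡⟨ sym (+-suc (length us) (length vs)) ⟩
  length us + length (x ∷ vs) ≡⟨ sym (length-++ us) ⟩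
  length (us ++ x ∷ vs)       ∎
  where
    open ≤-Reasoning
    xs⊆us++vs : All (_∈ us ++ vs) xs
    xs⊆us++vs = All.zipWith (λ (x≢z , z∈) → ∈-remove us vs x≢z z∈) (x∉xs , xs⊆ys)

module _ {n f : ℕ} (e : Execution n f) where
  open Execution e

  inCensus? : ∀ t v (g : Fin good) → Dec (inCensus e t v g)
  inCensus? t v g = (start g ≟ t) ×-dec (FinP._≟_ (posG g t) v)

  goodLabels : ℕ → Fin nodes → List Label
  goodLabels t v = map label (filter (inCensus? t v) (allFin good))

  censusLabels-split : ∀ t v →
    ∃ λ B → length B ≤ f × censusLabels e t v ≡ goodLabels t v ++ B
  censusLabels-split t v = _ , length-byzantine , refl
    where
      length-byzantine : ∀ {claims : Fin byz → _} → length (mapMaybe claims (allFin byz)) ≤ f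
      length-byzantine {claims} =
        ≤-trans (length-mapMaybe claims (allFin byz))
                (subst (_≤ f) (sym (length-tabulate (λ b → b))) byz≤f)

  ∈-HAt⁻ : ∀ {x t v} → x ∈ HAt e t v → x ∈ censusLabels e t v
  ∈-HAt⁻ {t = t} {v} x∈ = ∈-deduplicate⁻ _≟_ (censusLabels e t v) (∈-resp-↭ (sort-↭ _) x∈)

  ∈-HAt⁺ : ∀ {x t v} → x ∈ censusLabels e t v → x ∈ HAt e t v
  ∈-HAt⁺ x∈ = ∈-resp-↭ (↭-sym (sort-↭ _)) (∈-deduplicate⁺ _≟_ x∈)

  label∈HAt : ∀ {t v g} → inCensus e t v g → label g ∈ HAt e t v
  label∈HAt {g = g} c = ∈-HAt⁺ (∈-++⁺ˡ (∈-map∘filter⁺ label (inCensus? _ _) (g , ∈-allFin g , refl , c)))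

  -- A good label in a census belongs to a good agent of that census
  -- (labels of good agents are distinct).
  goodLabel-inCensus : ∀ {t v s} → label s ∈ goodLabels t v → inCensus e t v s
  goodLabel-inCensus {t} {v} s∈ with ∈-map∘filter⁻ label (inCensus? t v) {xs = allFin good} s∈
  ... | g , _ , ls≡lg , c = subst (inCensus e t v) (sym (label-inj ls≡lg)) c

  honestWitness : ∀ t v (S : List (Fin good)) → Unique S → f < length S →
    All (λ s → label s ∈ HAt e t v) S → Any (inCensus e t v) S
  honestWitness t v S S-unique f<∣S∣ S-heard with All.search (inCensus? t v) S
  ... | inj₂ witness = witness
  ... | inj₁ absent  with censusLabels-split t v
  ... | B , ∣B∣≤f , census≡ = ⊥-elim (<-irrefl refl (begin-strict
    f                    <⟨ f<∣S∣ ⟩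
    length S             ≡⟨ sym (length-map label S) ⟩
    length (map label S) ≤⟨ unique-⊆⇒length-≤ (map label S) B (map⁺ label-inj S-unique) (byzantine S S-heard absent) ⟩
    length B             ≤⟨ ∣B∣≤f ⟩
    f                    ∎))
    where
      open ≤-Reasoning
      byzantine : ∀ S′ → All (λ s → label s ∈ HAt e t v) S′ →
        All (λ s → ¬ inCensus e t v s) S′ → All (_∈ B) (map label S′)
      byzantine []       _            _              = []
      byzantine (s ∷ S′) (s∈ ∷ S′∈) (s∉ ∷ S′∉) with ∈-++⁻ (goodLabels t v) (subst (label s ∈_) census≡ (∈-HAt⁻ s∈))
      ... | inj₁ good∈ = ⊥-elim (s∉ (goodLabel-inCensus good∈))
      ... | inj₂ byz∈  = byz∈ ∷ byzantine S′ S′∈ S′∉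

  -- An agent is in Census at one round and node only: an agent of the census
  -- at (t, v) that also shares g's census shows that g is in Census at (t, v).
  sharedCensus : ∀ {t v} (g s : Fin good) → inCensus e t v s →
    inCensus e (start g) (posG g (start g)) s → inCensus e t v g
  sharedCensus g s (refl , refl) (s≡g , pos≡) =
    sym s≡g , subst (λ r → posG g r ≡ posG s r) (sym s≡g) (sym pos≡)

  H-inCensus : ∀ {t v g} → inCensus e t v g → H e g ≡ HAt e t v
  H-inCensus (refl , refl) = refl

  censusResult : ∀ {t v L} (S : List (Fin good)) → 0 < length S →
    All (λ s → inCensus e t v s × H e s ≡ L) S → HAt e t v ≡ L
  censusResult (_ ∷ _) _ ((s-census , s-builds) ∷ _) = trans (sym (H-inCensus s-census)) s-builds

  builderLocated : ∀ {t v} (S : List (Fin good)) → Unique S → f < length S →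
    All (inCensus e t v) S → ∀ g → All (λ s → label s ∈ H e g) S → inCensus e t v g
  builderLocated S S-unique f<∣S∣ S-census g S-heard =
    All.lookupWith (λ {s} → sharedCensus g s) S-census
      (honestWitness (start g) (posG g (start g)) S S-unique f<∣S∣ S-heard)

f<3f+2 : ∀ f → f < 3 * f + 2
f<3f+2 f = ≤-<-trans (m≤n*m f 3) (m<m+n (3 * f) z<s)

mainTheorem1 : (n f T : ℕ) (e : Execution n f)
    → (τ₀ : ℕ)
    → (∃ λ g → Execution.start e g ≡ τ₀)
    → (∀ g → τ₀ ≤ Execution.start e g)
    → (∀ g → Execution.start e g < τ₀ + T)
    → (∃ λ t → ∃ λ v → Σ (List (Fin (Execution.good e))) λ S →
    Unique S × 4 * f + 2 ≤ length S × All (inCensus e t v) S)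
    → (g₁ : List Label)
    → (∃ λ g → H e g ≡ g₁)
    → (∀ g → H e g ≡ g₁ ⊎ H e g ≺ g₁)
    → (τ₁ : ℕ) (v₁ : Fin (Execution.nodes e))
    → (Σ (List (Fin (Execution.good e))) λ S →
    Unique S × 3 * f + 2 ≤ length S × All (λ g → inCensus e τ₁ v₁ g × H e g ≡ g₁) S)
    → ∀ g → (H e g ≡ g₁) ⇔ inCensus e τ₁ v₁ g
mainTheorem1 n f T e τ₀ _ _ _ _ g₁ _ _ τ₁ v₁ (S , S-unique , ∣S∣≥3f+2 , S-builds) g =
  mk⇔ buildsOnlyIfIn inBuilds
  where
    f<∣S∣ : f < length S
    f<∣S∣ = ≤-trans (f<3f+2 f) ∣S∣≥3f+2

    HAt≡g₁ : HAt e τ₁ v₁ ≡ g₁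
    HAt≡g₁ = censusResult e S (≤-<-trans z≤n f<∣S∣) S-builds

    buildsOnlyIfIn : H e g ≡ g₁ → inCensus e τ₁ v₁ g
    buildsOnlyIfIn Hg≡g₁ =
      builderLocated e S S-unique f<∣S∣ (All.map (λ (c , _) → c) S-builds) g
        (All.map (λ (c , _) → subst (_ ∈_) (trans HAt≡g₁ (sym Hg≡g₁)) (label∈HAt e c)) S-builds)

    inBuilds : inCensus e τ₁ v₁ g → H e g ≡ g₁
    inBuilds c = trans (H-inCensus e c) HAt≡g₁
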